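{- Let $1\le k\le n$ and let $f:\{0,1\}^n\to\{0,1\}$ be the $k$-of-$n$ function. Then $\Gamma^1(f)=k$ and $\Gamma^0(f)=n-k+1$.
   Context: The $k$-of-$n$ function outputs $1$ iff at least $k$ of its $n$ input bits are $1$. A partial assignment is $b\in\{0,1,*\}^n$; $a\succeq b$ means $a_i=b_i$ whenever $b_i\ne *$. $b$ is a $0$-certificate (resp. $1$-certificate) of $f$ if $f(a)=0$ (resp. $1$) for all $a\in\{0,1\}^n$ with $a\succeq b$. For $b_i=*$, $b_{x_i\leftarrow\ell}$ is $b$ with coordinate $i$ set to $\ell\in\{0,1\}$. $g:\{0,1,*\}^n\to\mathbb{Z}_{\ge0}$ is monotone if $g(b_{x_i\leftarrow\ell})\ge g(b)$ whenever $b_i=*$, and submodular if $g(b_{x_i\leftarrow\ell})-g(b)\ge g(b'_{x_i\leftarrow\ell})-g(b')$ whenever $b'\succeq b$, $b_i=b'_i=*$. A $1$-goal function for $f$ is a monotone submodular $g$ with a constant $Q\ge0$ (its $1$-goal value) such that $g(b)=Q$ if $b$ is a $1$-certificate of $f$ and $g(b)<Q$ otherwise; $\Gamma^1(f)$ is the minimum $1$-goal value of a $1$-goal function for $f$. $0$-goal functions and $\Gamma^0(f)$ are defined analogously with $0$-certificates. -}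

module Defs where

open import Data.Nat using (ℕ; zero; suc; _+_; _≤_; _<_; _≤ᵇ_)
open import Data.Bool using (Bool; true; false; if_then_else_)
open import Data.Maybe using (Maybe; just; nothing)
open import Data.Fin using (Fin; zero; suc; _≟_)
open import Data.Product using (Σ; _×_; ∃)
open import Relation.Nullary using (¬_; yes; no)
open import Relation.Binary.PropositionalEquality using (_≡_)

-- Total assignments {0,1}^n (true = 1, false = 0)
Assignment : ℕ → Set
Assignment n = Fin n → Bool

-- Partial assignments {0,1,*}^n  (nothing = *)
Partial : ℕ → Set
Partial n = Fin n → Maybe Bool

BoolFun : ℕ → Set
BoolFun n = Assignment n → Bool

countOnes : ∀ {n} → Assignment n → ℕ
countOnes {zero}  a = 0
countOnes {suc n} a = (if a zero then 1 else 0) + countOnes (λ i → a (suc i))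

kOfN : (n k : ℕ) → BoolFun n
kOfN n k a = k ≤ᵇ countOnes a

_⪰_ : ∀ {n} → Assignment n → Partial n → Set
a ⪰ b = ∀ i ℓ → b i ≡ just ℓ → a i ≡ ℓ

_⪰ₚ_ : ∀ {n} → Partial n → Partial n → Set
b' ⪰ₚ b = ∀ i ℓ → b i ≡ just ℓ → b' i ≡ just ℓ

Certificate : ∀ {n} → Bool → BoolFun n → Partial n → Set
Certificate ℓ f b = ∀ a → a ⪰ b → f a ≡ ℓ

assign : ∀ {n} → Partial n → Fin n → Bool → Partial n
assign b i ℓ j with i ≟ j
... | yes _ = just ℓ
... | no  _ = b j

Monotone : ∀ {n} → (Partial n → ℕ) → Set
Monotone {n} g = ∀ (b : Partial n) i ℓ → b i ≡ nothing → g b ≤ g (assign b i ℓ)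

-- g(b_{i←ℓ}) - g(b) ≥ g(b'_{i←ℓ}) - g(b'), written additively (exact in ℕ/ℤ)
Submodular : ∀ {n} → (Partial n → ℕ) → Set
Submodular {n} g = ∀ (b b' : Partial n) i ℓ → b' ⪰ₚ b → b i ≡ nothing → b' i ≡ nothing →
  g (assign b' i ℓ) + g b ≤ g (assign b i ℓ) + g b'

GoalFunction : ∀ {n} → Bool → BoolFun n → (Partial n → ℕ) → ℕ → Set
GoalFunction ℓ f g Q =
  Monotone g × Submodular g ×
  (∀ b → Certificate ℓ f b → g b ≡ Q) ×
  (∀ b → ¬ Certificate ℓ f b → g b < Q)

IsGamma : ∀ {n} → Bool → BoolFun n → ℕ → Set
IsGamma {n} ℓ f Q =
  (Σ (Partial n → ℕ) λ g → GoalFunction ℓ f g Q) ×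
  (∀ (g : Partial n → ℕ) Q' → GoalFunction ℓ f g Q' → Q ≤ Q')

-- Both functions are thresholds: f(a) = ℓ iff at least K coordinates of a equal ℓ, with
-- (ℓ, K) = (1, k) or (0, n − k + 1). For a threshold, the ℓ-certificates are the partial
-- assignments fixing at least K coordinates to ℓ, and min(K, number of coordinates fixed
-- to ℓ) is a goal function of value K; it is submodular because min(K, ·) is concave.
-- Conversely, follow a goal function g of value Q along the chain fixing coordinates
-- 0, …, K − 1 to ℓ one at a time. By submodularity, step m gains at least as much as the
-- same step taken from the full certificate with coordinate m erased; that step turns a
-- non-certificate into a certificate, so it gains at least 1. Hence Q ≥ K.
module Submission where

open import Defs
open import Data.Nat
  using (ℕ; zero; suc; _≤_; _<_; _∸_; _+_; _⊓_; _≤ᵇ_; _≤′_; ≤′-refl; ≤′-step; z≤n; _≤?_)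
open import Data.Nat.Properties hiding (_≟_; suc-injective)
open import Data.Bool using (Bool; true; false; if_then_else_; not) renaming (_≟_ to _≟ᵇ_)
open import Data.Bool.Properties using (T-≡)
open import Data.Maybe using (Maybe; just; nothing; maybe′; fromMaybe)
open import Data.Fin using (Fin; zero; suc; toℕ; fromℕ<; _≟_)
open import Data.Fin.Properties using (toℕ-fromℕ<; suc-injective)
open import Data.Product using (_×_; _,_)
open import Function using (_∘_)
open import Function.Bundles using (_⇔_; mk⇔; Equivalence)
open import Function.Properties.Equivalence using () renaming (trans to ⇔-trans)
open import Relation.Nullary using (¬_; yes; no; contradiction)
open import Relation.Binary.PropositionalEquality

private
  variable
    n K Q : ℕ
    ℓ x : Bool
    f : BoolFun n
    g : Partial n → ℕ
    a : Assignment n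
    b b' : Partial n
    i : Fin n

countOnes-cong : {a a' : Assignment n} → (∀ i → a i ≡ a' i) → countOnes a ≡ countOnes a'
countOnes-cong {zero} _ = refl
countOnes-cong {suc n} eq =
  cong₂ _+_ (cong (λ y → if y then 1 else 0) (eq zero)) (countOnes-cong (eq ∘ suc))

countOnes-mono : {a a' : Assignment n} → (∀ i → a i ≡ true → a' i ≡ true) →
  countOnes a ≤ countOnes a'
countOnes-mono {zero} _ = z≤n
countOnes-mono {suc n} {a} {a'} imp with a zero in e | a' zero in e′
... | true  | true  = +-monoʳ-≤ 1 (countOnes-mono (imp ∘ suc))
... | true  | false = contradiction (trans (sym (imp zero e)) e′) λ ()
... | false | true  = m≤n⇒m≤1+n (countOnes-mono (imp ∘ suc))
... | false | false = countOnes-mono (imp ∘ suc)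

countOnes-flip : {a a' : Assignment n} → a i ≡ false → a' i ≡ true →
  (∀ j → i ≢ j → a j ≡ a' j) → countOnes a' ≡ suc (countOnes a)
countOnes-flip {i = zero} ai a'i eq rewrite ai | a'i =
  cong suc (sym (countOnes-cong λ j → eq (suc j) λ ()))
countOnes-flip {i = suc i} {a' = a'} ai a'i eq rewrite eq zero (λ ()) with a' zero
... | true  = cong suc (countOnes-flip ai a'i λ j i≢j → eq (suc j) (i≢j ∘ suc-injective))
... | false = countOnes-flip ai a'i λ j i≢j → eq (suc j) (i≢j ∘ suc-injective)

countOnes-false : countOnes {n} (λ _ → false) ≡ 0
countOnes-false {zero} = refl
countOnes-false {suc n} = countOnes-false {n}

countOnes+countOnes-not : (a : Assignment n) → countOnes a + countOnes (not ∘ a) ≡ n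
countOnes+countOnes-not {zero} a = refl
countOnes+countOnes-not {suc n} a with a zero
... | true  = cong suc (countOnes+countOnes-not (a ∘ suc))
... | false =
  trans (+-suc (countOnes (a ∘ suc)) _) (cong suc (countOnes+countOnes-not (a ∘ suc)))

-- Tests x ≡ ℓ; for ℓ = true it is the identity, so `count true` is `countOnes` on the nose.
is : Bool → Bool → Bool
is ℓ x = if ℓ then x else not x

is-self : ∀ ℓ → is ℓ ℓ ≡ true
is-self true  = refl
is-self false = refl

is-not : ∀ ℓ → is ℓ (not ℓ) ≡ false
is-not true  = refl
is-not false = refl

is-sound : ∀ ℓ x → is ℓ x ≡ true → x ≡ ℓ
is-sound true  true  _ = refl
is-sound false false _ = refl

is-≢ : ∀ ℓ x → x ≢ ℓ → is ℓ x ≡ false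
is-≢ true  true  x≢ℓ = contradiction refl x≢ℓ
is-≢ true  false _   = refl
is-≢ false true  _   = refl
is-≢ false false x≢ℓ = contradiction refl x≢ℓ

count : Bool → Assignment n → ℕ
count ℓ a = countOnes (is ℓ ∘ a)

fixedTo : Bool → Maybe Bool → Bool
fixedTo ℓ = maybe′ (is ℓ) false

fixedTo-sound : ∀ ℓ m → fixedTo ℓ m ≡ true → m ≡ just ℓ
fixedTo-sound ℓ (just x) e = cong just (is-sound ℓ x e)

fixed : Bool → Partial n → ℕ
fixed ℓ b = countOnes (fixedTo ℓ ∘ b)

fixed-cong : (∀ j → b j ≡ b' j) → fixed ℓ b ≡ fixed ℓ b'
fixed-cong {ℓ = ℓ} eq = countOnes-cong (cong (fixedTo ℓ) ∘ eq)

fixed-mono : b' ⪰ₚ b → fixed ℓ b ≤ fixed ℓ b'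
fixed-mono {b' = b'} {b = b} {ℓ = ℓ} b'⪰b = countOnes-mono λ i e →
  trans (cong (fixedTo ℓ) (b'⪰b i ℓ (fixedTo-sound ℓ (b i) e))) (is-self ℓ)

fixed≤count : a ⪰ b → fixed ℓ b ≤ count ℓ a
fixed≤count {a = a} {b = b} {ℓ = ℓ} a⪰b = countOnes-mono λ i e →
  trans (cong (is ℓ) (a⪰b i ℓ (fixedTo-sound ℓ (b i) e))) (is-self ℓ)

complete : Bool → Partial n → Assignment n
complete ℓ b = fromMaybe (not ℓ) ∘ b

complete-⪰ : complete ℓ b ⪰ b
complete-⪰ {ℓ = ℓ} i x e = cong (fromMaybe (not ℓ)) e

count-complete : (b : Partial n) → count ℓ (complete ℓ b) ≡ fixed ℓ b
count-complete {ℓ = ℓ} b = countOnes-cong λ i → lemma (b i)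
  where
  lemma : ∀ m → is ℓ (fromMaybe (not ℓ) m) ≡ fixedTo ℓ m
  lemma (just _) = refl
  lemma nothing  = is-not ℓ

⪰ₚ-refl : b ⪰ₚ b
⪰ₚ-refl _ _ e = e

⪰ₚ-trans : {b b' b'' : Partial n} → b'' ⪰ₚ b' → b' ⪰ₚ b → b'' ⪰ₚ b
⪰ₚ-trans p q i x = p i x ∘ q i x

assign-same : (b : Partial n) (i : Fin n) → assign b i x i ≡ just x
assign-same b i with i ≟ i
... | yes _  = refl
... | no i≢i = contradiction refl i≢i

assign-other : (b : Partial n) {j : Fin n} → i ≢ j → assign b i x j ≡ b j
assign-other {i = i} b {j} i≢j with i ≟ j
... | yes i≡j = contradiction i≡j i≢j
... | no _    = refl

assign-⪰ₚ : (b : Partial n) (i : Fin n) → b i ≡ nothing → assign b i x ⪰ₚ b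
assign-⪰ₚ b i bi j y e with i ≟ j
... | yes refl = contradiction (trans (sym bi) e) λ ()
... | no _     = e

fixed-assign-self : ∀ ℓ (b : Partial n) (i : Fin n) → b i ≡ nothing →
  fixed ℓ (assign b i ℓ) ≡ suc (fixed ℓ b)
fixed-assign-self ℓ b i bi = countOnes-flip (cong (fixedTo ℓ) bi)
  (trans (cong (fixedTo ℓ) (assign-same b i)) (is-self ℓ))
  (λ j i≢j → cong (fixedTo ℓ) (sym (assign-other b i≢j)))

fixed-assign-≢ : ∀ ℓ (b : Partial n) (i : Fin n) → b i ≡ nothing → x ≢ ℓ →
  fixed ℓ (assign b i x) ≡ fixed ℓ b
fixed-assign-≢ {x = x} ℓ b i bi x≢ℓ = countOnes-cong λ j → lemma j
  where
  lemma : ∀ j → fixedTo ℓ (assign b i x j) ≡ fixedTo ℓ (b j)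
  lemma j with i ≟ j
  ... | yes refl = trans (is-≢ ℓ x x≢ℓ) (sym (cong (fixedTo ℓ) bi))
  ... | no _     = refl

erase : Partial n → Fin n → Partial n
erase b i j with i ≟ j
... | yes _ = nothing
... | no _  = b j

erase-same : (b : Partial n) (i : Fin n) → erase b i i ≡ nothing
erase-same b i with i ≟ i
... | yes _  = refl
... | no i≢i = contradiction refl i≢i

erase-other : (b : Partial n) {j : Fin n} → i ≢ j → erase b i j ≡ b j
erase-other {i = i} b {j} i≢j with i ≟ j
... | yes i≡j = contradiction i≡j i≢j
... | no _    = refl

erase-⪰ₚ : {c : Partial n} (i : Fin n) → b ⪰ₚ c → c i ≡ nothing → erase b i ⪰ₚ c
erase-⪰ₚ i b⪰c ci j y e with i ≟ j
... | yes refl = contradiction (trans (sym ci) e) λ ()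
... | no _     = b⪰c j y e

assign-erase : (b : Partial n) (i : Fin n) → b i ≡ just x →
  ∀ j → assign (erase b i) i x j ≡ b j
assign-erase b i bi j with i ≟ j
... | yes refl = sym bi
... | no i≢j   = erase-other b i≢j

fixed-erase : ∀ ℓ (b : Partial n) (i : Fin n) → b i ≡ just ℓ →
  suc (fixed ℓ (erase b i)) ≡ fixed ℓ b
fixed-erase ℓ b i bi =
  trans (sym (fixed-assign-self ℓ (erase b i) i (erase-same b i)))
        (fixed-cong (assign-erase b i bi))

-- The bound is irrelevant, so prefixes built from different proofs of it agree definitionally.
prefix : Bool → (m : ℕ) → .(m ≤ n) → Partial n
prefix ℓ zero    _   = λ _ → nothing
prefix ℓ (suc m) m<n = assign (prefix ℓ m (<⇒≤ m<n)) (fromℕ< m<n) ℓ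

prefix-unset : ∀ ℓ m .(m≤n : m ≤ n) (i : Fin n) → m ≤ toℕ i →
  prefix ℓ m m≤n i ≡ nothing
prefix-unset ℓ zero    _   i _   = refl
prefix-unset ℓ (suc m) m<n i m<i =
  trans (assign-other (prefix ℓ m _) pos≢i) (prefix-unset ℓ m _ i (<⇒≤ m<i))
  where
  pos≢i : fromℕ< m<n ≢ i
  pos≢i refl = <-irrefl (sym (toℕ-fromℕ< m<n)) m<i

prefix-next-unset : ∀ ℓ m .(m<n : m < n) → prefix ℓ m (<⇒≤ m<n) (fromℕ< m<n) ≡ nothing
prefix-next-unset ℓ m m<n =
  prefix-unset ℓ m _ (fromℕ< m<n) (≤-reflexive (sym (toℕ-fromℕ< m<n)))

prefix-mono : ∀ {m K} .(m≤n : m ≤ n) .(K≤n : K ≤ n) → m ≤′ K →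
  prefix ℓ K K≤n ⪰ₚ prefix ℓ m m≤n
prefix-mono _ _ ≤′-refl = ⪰ₚ-refl
prefix-mono {ℓ = ℓ} {K = suc K} m≤n K<n (≤′-step m≤K) =
  ⪰ₚ-trans (assign-⪰ₚ _ (fromℕ< K<n) (prefix-next-unset ℓ K K<n))
           (prefix-mono m≤n (<⇒≤ K<n) m≤K)

fixed-prefix : ∀ ℓ m .(m≤n : m ≤ n) → fixed ℓ (prefix ℓ m m≤n) ≡ m
fixed-prefix {n} ℓ zero _ = countOnes-false {n}
fixed-prefix {n} ℓ (suc m) m<n =
  trans (fixed-assign-self ℓ _ (fromℕ< m<n) (prefix-next-unset ℓ m m<n))
        (cong suc (fixed-prefix {n} ℓ m _))

⊓-suc-concave : ∀ K {p q} → p ≤ q → K ⊓ suc q + K ⊓ p ≤ K ⊓ suc p + K ⊓ q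
⊓-suc-concave K {p} {q} p≤q with K ≤? q
... | yes K≤q = begin
  K ⊓ suc q + K ⊓ p  ≡⟨ cong (_+ K ⊓ p) (m≤n⇒m⊓n≡m (m≤n⇒m≤1+n K≤q)) ⟩
  K + K ⊓ p          ≤⟨ +-monoʳ-≤ K (⊓-monoʳ-≤ K (n≤1+n p)) ⟩
  K + K ⊓ suc p      ≡⟨ +-comm K _ ⟩
  K ⊓ suc p + K      ≡⟨ cong (K ⊓ suc p +_) (sym (m≤n⇒m⊓n≡m K≤q)) ⟩
  K ⊓ suc p + K ⊓ q  ∎
  where open ≤-Reasoning
... | no K≰q = untruncated (≰⇒> K≰q)
  where
  untruncated : q < K → K ⊓ suc q + K ⊓ p ≤ K ⊓ suc p + K ⊓ q
  untruncated q<K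
    rewrite m≥n⇒m⊓n≡n q<K | m≥n⇒m⊓n≡n (<⇒≤ q<K)
          | m≥n⇒m⊓n≡n (≤-<-trans p≤q q<K) | m≥n⇒m⊓n≡n (<⇒≤ (≤-<-trans p≤q q<K))
    = ≤-reflexive (cong suc (+-comm q p))

-- The step gains at b at least as much as at b', where it turns a non-certificate into
-- a certificate and so gains a positive amount.
goal-assign-< : GoalFunction ℓ f g Q → b' ⪰ₚ b → b i ≡ nothing → b' i ≡ nothing →
  Certificate ℓ f (assign b' i x) → ¬ Certificate ℓ f b' → g b < g (assign b i x)
goal-assign-< {g = g} {Q = Q} {b' = b'} {b = b} {i = i} {x = x}
  (_ , submodular , certificate-value , non-certificate-value) b'⪰b bi b'i c nc =
  +-cancelˡ-< Q (g b) (g (assign b i x)) (begin-strict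
    Q + g b                  ≡⟨ cong (_+ g b) (sym (certificate-value _ c)) ⟩
    g (assign b' i x) + g b  ≤⟨ submodular b b' i x b'⪰b bi b'i ⟩
    g (assign b i x) + g b'  <⟨ +-monoʳ-< (g (assign b i x)) (non-certificate-value b' nc) ⟩
    g (assign b i x) + Q     ≡⟨ +-comm _ Q ⟩
    Q + g (assign b i x)     ∎)
  where open ≤-Reasoning

IsThreshold : Bool → BoolFun n → ℕ → Set
IsThreshold ℓ f K = ∀ a → f a ≡ ℓ ⇔ K ≤ count ℓ a

module _ (ℓ : Bool) (f : BoolFun n) (K : ℕ) (threshold : IsThreshold ℓ f K) where

  certificate⇔ : (b : Partial n) → Certificate ℓ f b ⇔ K ≤ fixed ℓ b
  certificate⇔ b = mk⇔
    (λ c → subst (K ≤_) (count-complete b)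
                 (Equivalence.to (threshold (complete ℓ b)) (c (complete ℓ b) complete-⪰)))
    (λ K≤b a a⪰b → Equivalence.from (threshold a) (≤-trans K≤b (fixed≤count a⪰b)))

  truncated-fixed-goal : GoalFunction ℓ f (λ b → K ⊓ fixed ℓ b) K
  truncated-fixed-goal = monotone , submodular , certificate-value , non-certificate-value
    where
    monotone : Monotone (λ b → K ⊓ fixed ℓ b)
    monotone b i x bi = ⊓-monoʳ-≤ K (fixed-mono (assign-⪰ₚ {x = x} b i bi))

    submodular : Submodular (λ b → K ⊓ fixed ℓ b)
    submodular b b' i x b'⪰b bi b'i with x ≟ᵇ ℓ
    ... | yes refl = subst₂ (λ p q → K ⊓ p + K ⊓ fixed ℓ b ≤ K ⊓ q + K ⊓ fixed ℓ b')
      (sym (fixed-assign-self ℓ b' i b'i)) (sym (fixed-assign-self ℓ b i bi))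
      (⊓-suc-concave K (fixed-mono {ℓ = ℓ} b'⪰b))
    ... | no x≢ℓ = subst₂ (λ p q → K ⊓ p + K ⊓ fixed ℓ b ≤ K ⊓ q + K ⊓ fixed ℓ b')
      (sym (fixed-assign-≢ ℓ b' i b'i x≢ℓ)) (sym (fixed-assign-≢ ℓ b i bi x≢ℓ))
      (≤-reflexive (+-comm (K ⊓ fixed ℓ b') (K ⊓ fixed ℓ b)))

    certificate-value : ∀ b → Certificate ℓ f b → K ⊓ fixed ℓ b ≡ K
    certificate-value b c = m≤n⇒m⊓n≡m (Equivalence.to (certificate⇔ b) c)

    non-certificate-value : ∀ b → ¬ Certificate ℓ f b → K ⊓ fixed ℓ b < K
    non-certificate-value b nc = m<n⇒o⊓m<n K (≰⇒> (nc ∘ Equivalence.from (certificate⇔ b)))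

  erase-¬certificate : (b : Partial n) (i : Fin n) → fixed ℓ b ≡ K → b i ≡ just ℓ →
    ¬ Certificate ℓ f (erase b i)
  erase-¬certificate b i bK bi c =
    <⇒≱ (subst (fixed ℓ (erase b i) <_) (trans (fixed-erase ℓ b i bi) bK) (n<1+n _))
        (Equivalence.to (certificate⇔ (erase b i)) c)

  assign-erase-certificate : (b : Partial n) (i : Fin n) → fixed ℓ b ≡ K → b i ≡ just ℓ →
    Certificate ℓ f (assign (erase b i) i ℓ)
  assign-erase-certificate b i bK bi = Equivalence.from (certificate⇔ (assign (erase b i) i ℓ))
    (≤-reflexive (sym (trans (fixed-cong (assign-erase b i bi)) bK)))

  goal-value-≥ : K ≤ n → GoalFunction ℓ f g Q → K ≤ Q
  goal-value-≥ {g = g} K≤n goal@(_ , _ , certificate-value , _) =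
    subst (K ≤_) (certificate-value target target-certificate) (ascend K ≤-refl)
    where
    target : Partial n
    target = prefix ℓ K K≤n

    fixed-target : fixed ℓ target ≡ K
    fixed-target = fixed-prefix ℓ K K≤n

    target-certificate : Certificate ℓ f target
    target-certificate = Equivalence.from (certificate⇔ target) (≤-reflexive (sym fixed-target))

    ascend : ∀ m (m≤K : m ≤ K) → m ≤ g (prefix ℓ m (≤-trans m≤K K≤n))
    ascend zero    _   = z≤n
    ascend (suc m) m<K = ≤-<-trans (ascend m (<⇒≤ m<K))
      (goal-assign-< goal below unset (erase-same target pos)
        (assign-erase-certificate target pos fixed-target set)
        (erase-¬certificate target pos fixed-target set))
      where
      m<n : m < n
      m<n = <-≤-trans m<K K≤n

      pos : Fin n
      pos = fromℕ< m<n

      unset : prefix ℓ m (<⇒≤ m<n) pos ≡ nothing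
      unset = prefix-next-unset ℓ m m<n

      set : target pos ≡ just ℓ
      set = prefix-mono m<n K≤n (≤⇒≤′ m<K) pos ℓ (assign-same (prefix ℓ m _) pos)

      below : erase target pos ⪰ₚ prefix ℓ m (<⇒≤ m<n)
      below = erase-⪰ₚ pos (prefix-mono _ K≤n (≤⇒≤′ (<⇒≤ m<K))) unset

  threshold-gamma : K ≤ n → IsGamma ℓ f K
  threshold-gamma K≤n = (_ , truncated-fixed-goal) , λ g Q goal → goal-value-≥ K≤n goal

≤ᵇ≡true⇔≤ : ∀ m n → (m ≤ᵇ n) ≡ true ⇔ m ≤ n
≤ᵇ≡true⇔≤ m n = mk⇔ (≤ᵇ⇒≤ m n ∘ Equivalence.from T-≡) (Equivalence.to T-≡ ∘ ≤⇒≤ᵇ)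

≤ᵇ≡false⇔> : ∀ m n → (m ≤ᵇ n) ≡ false ⇔ n < m
≤ᵇ≡false⇔> m n =
  mk⇔ (λ e → ≰⇒> λ m≤n → contradiction (trans (sym e) (from m≤n)) λ ()) (from′ _ refl)
  where
  open Equivalence (≤ᵇ≡true⇔≤ m n)
  from′ : ∀ y → (m ≤ᵇ n) ≡ y → n < m → (m ≤ᵇ n) ≡ false
  from′ true  e n<m = contradiction (to e) (<⇒≱ n<m)
  from′ false e _   = e

complement-threshold : ∀ {c z n k} → c + z ≡ n → k ≤ n → c < k ⇔ n ∸ k + 1 ≤ z
complement-threshold {c} {z} {n} {k} c+z≡n k≤n = mk⇔
  (λ c<k → +-cancelʳ-≤ c _ _ (subst₂ _≤_ (sym lhs) (sym rhs) (+-monoʳ-≤ (n ∸ k) c<k)))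
  (λ le → +-cancelˡ-≤ (n ∸ k) _ _ (subst₂ _≤_ lhs rhs (+-monoˡ-≤ c le)))
  where
  lhs : n ∸ k + 1 + c ≡ n ∸ k + suc c
  lhs = +-assoc (n ∸ k) 1 c
  rhs : z + c ≡ n ∸ k + k
  rhs = trans (+-comm z c) (trans c+z≡n (sym (m∸n+n≡m k≤n)))

kOfN-threshold-true : ∀ n k → IsThreshold true (kOfN n k) k
kOfN-threshold-true n k a = ≤ᵇ≡true⇔≤ k (countOnes a)

kOfN-threshold-false : ∀ {n k} → k ≤ n → IsThreshold false (kOfN n k) (n ∸ k + 1)
kOfN-threshold-false {k = k} k≤n a =
  ⇔-trans (≤ᵇ≡false⇔> k (countOnes a)) (complement-threshold (countOnes+countOnes-not a) k≤n)

proposition4 : (n k : ℕ) → 1 ≤ k → k ≤ n →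
    IsGamma true (kOfN n k) k × IsGamma false (kOfN n k) (n ∸ k + 1)
proposition4 n k 1≤k k≤n =
  threshold-gamma true (kOfN n k) k (kOfN-threshold-true n k) k≤n ,
  threshold-gamma false (kOfN n k) (n ∸ k + 1) (kOfN-threshold-false k≤n) n∸k+1≤n
  where
  n∸k+1≤n : n ∸ k + 1 ≤ n
  n∸k+1≤n = ≤-trans (+-monoʳ-≤ (n ∸ k) 1≤k) (≤-reflexive (m∸n+n≡m k≤n))
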